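{- Let $G$ be a $2$-connected chordal graph with threshold function $\theta$ satisfying $\theta(v)\le 2$ for every vertex $v$ of $G$. Then $\text{min-seed}(G,\theta)=2$ if and only if $\theta(v)=2$ for every vertex $v$ of $G$.
   Context: A graph is chordal if it has no induced cycle of length greater than three. For a finite simple graph $G$ with threshold function $\theta:V(G)\to\mathbb{Z}$ and a target set $S\subseteq V(G)$, the activation process is: at time $0$ the vertices of $S$ are active and all others inactive; at each subsequent time step, every inactive vertex $u$ having at least $\theta(u)$ active neighbours becomes active. The process stops when no more vertices become active; $[S]^G_\theta$ denotes the set of active vertices at the end. $\text{min-seed}(G,\theta)=\min\{|S|: S\subseteq V(G),\ [S]^G_\theta=V(G)\}$. -}

module Defs where

open import Data.Nat using (ℕ; zero; suc; _≤_; _∸_)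
open import Data.Fin using (Fin; toℕ)
open import Data.Fin.Subset using (Subset; _∩_; ∣_∣)
import Data.Fin.Subset as Sub
open import Data.Bool using (Bool; true; false; _∨_)
open import Data.Integer as ℤ using (ℤ; +_)
open import Data.Vec using (tabulate; lookup)
open import Data.Product using (Σ; _×_; ∃)
open import Data.Sum using (_⊎_)
open import Data.Unit using (⊤)
open import Function using (Injective; _∘_)
open import Function.Bundles using (_⇔_)
open import Relation.Nullary using (¬_; does)
open import Relation.Binary.PropositionalEquality using (_≡_; _≢_)

record Graph : Set where
  field
    n      : ℕ
    adj    : Fin n → Fin n → Bool
    sym    : ∀ u v → adj u v ≡ adj v u
    irrefl : ∀ v → adj v v ≡ false
open Graph public

module _ (G : Graph) where
  private
    N = n G
    A = adj G

  data Walk (P : Fin N → Set) : Fin N → Fin N → Set where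
    here : ∀ {u} → P u → Walk P u u
    step : ∀ {u w v} → P u → A u w ≡ true → Walk P w v → Walk P u v

  Connected : Set
  Connected = ∀ u v → Walk (λ _ → ⊤) u v

  ConnectedWithout : Fin N → Set
  ConnectedWithout x = ∀ u v → u ≢ x → v ≢ x → Walk (λ w → w ≢ x) u v

  TwoConnected : Set
  TwoConnected = (3 ≤ N) × Connected × (∀ x → ConnectedWithout x)

  CycAdj : (k : ℕ) → Fin k → Fin k → Set
  CycAdj k i j = (toℕ j ≡ suc (toℕ i)) ⊎ (toℕ i ≡ suc (toℕ j))
               ⊎ (toℕ i ≡ 0 × toℕ j ≡ k ∸ 1) ⊎ (toℕ j ≡ 0 × toℕ i ≡ k ∸ 1)

  InducedCycle : ℕ → Set
  InducedCycle k = Σ (Fin k → Fin N) λ c →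
    Injective _≡_ _≡_ c × (∀ i j → (A (c i) (c j) ≡ true) ⇔ CycAdj k i j)

  Chordal : Set
  Chordal = ∀ k → 4 ≤ k → ¬ InducedCycle k

  Threshold : Set
  Threshold = Fin N → ℤ

  neighbourhood : Fin N → Subset N
  neighbourhood u = tabulate (A u)

  activationStep : Threshold → Subset N → Subset N
  activationStep θ S = tabulate λ u →
    lookup S u ∨ does (θ u ℤ.≤? + ∣ neighbourhood u ∩ S ∣)

  iterate : ℕ → (Subset N → Subset N) → Subset N → Subset N
  iterate zero    f S = S
  iterate (suc t) f S = f (iterate t f S)

  -- [S]_θ : the process stabilises within N steps (each non-final step
  -- activates a new vertex), so the final active set is the state at time N.
  closure : Threshold → Subset N → Subset N
  closure θ S = iterate N (activationStep θ) S

  MinSeedIs : Threshold → ℕ → Set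
  MinSeedIs θ k =
    (∃ λ S → closure θ S ≡ Sub.⊤ × ∣ S ∣ ≡ k) ×
    (∀ S → closure θ S ≡ Sub.⊤ → k ≤ ∣ S ∣)

module Submission where

-- The heart of the proof is a percolation lemma: when θ ≤ 2, the two ends of any edge uv
-- activate the whole graph. The active set always contains a connected cluster D around uv. If
-- D is not everything, some vertex outside D has two neighbours in D, hence becomes active in
-- the next round: otherwise 2-connectivity yields a path outside D from a neighbour of some
-- x ∈ D to a neighbour of some other a ∈ D, without further edges into D, and together with an
-- induced x–a path inside D it closes an induced cycle of length at least 4, contradicting
-- chordality. So the cluster grows every round until it fills the graph.
--
-- If θ ≡ 2, an edge is a seed, while a set with at most one vertex never
-- grows. If θ(v) ≤ 1 for some v, a single neighbour w of v activates v in the first round, and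
-- then the edge vw percolates, so {w} is a seed of size 1.

open import Defs
open import Data.Fin using (Fin)
open import Data.Integer using (ℤ; +_; _≤_)
open import Function.Bundles using (_⇔_)
open import Relation.Binary.PropositionalEquality using (_≡_)

open import Data.Bool using (true; false; _∨_) renaming (_≟_ to _≟ᵇ_)
open import Data.Bool.Properties using (∨-zeroʳ; ∨-identityʳ)
open import Data.Empty using (⊥; ⊥-elim)
open import Data.Fin using (zero; suc; toℕ; fromℕ<) renaming (_≟_ to _≟ᶠ_)
open import Data.Fin.Properties using (any?)
open import Data.Fin.Subset as Subset using (Subset; _∈_; _∉_; _⊆_; _∩_; _∪_; _-_; ⁅_⁆; ∣_∣)
open import Data.Fin.Subset.Properties
  using ( _∈?_; x∈p⇒∣p-x∣<∣p∣; x∈p∧x≢y⇒x∈p-y; ∣p∣≤∣x∷p∣; ∣p∣≤n; ∣⁅x⁆∣≡1; x∈⁅x⁆; x∈⁅y⁆⇒x≡y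
        ; x∈p∪q⁺; x∈p∪q⁻; x∈p∩q⁺; ∣p∩q∣≤∣q∣; ∣⊤∣≡n; p⊂q⇒∣p∣<∣q∣; ⊆-antisym; ⊆⊤ )
import Data.Vec as Vec
open import Data.Vec.Properties using (lookup∘tabulate; lookup⇒[]=; []=⇒lookup)
open import Data.Integer as ℤ using (+≤+)
import Data.Integer.Properties as ℤ
open import Data.List as List using (List; []; _∷_; _++_; length)
open import Data.List.Properties using (length-++; length-++-≤ʳ; ++-conicalʳ)
open import Data.List.Membership.Propositional.Properties using (∈-lookup)
open import Data.List.Relation.Unary.All as All using (All; []; _∷_)
open import Data.List.Relation.Unary.All.Properties using (++⁺; ++⁻ˡ; ++⁻ʳ; ¬Any⇒All¬)
open import Data.List.Relation.Unary.Any as Any using (Any; here; there)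
open import Data.Nat as ℕ using (ℕ; suc; _+_; _∸_; z≤n; s≤s)
import Data.Nat.Properties as ℕ
open import Data.Product using (Σ; ∃; _×_; _,_; proj₁; proj₂)
open import Data.Sum using (_⊎_; inj₁; inj₂) renaming (map to ⊎-map)
open import Data.Unit using (⊤; tt)
open import Function using (_∘_; case_of_)
open import Function.Bundles using (Equivalence; mk⇔)
open import Relation.Nullary using (¬_; Dec; yes; no; does)
open import Relation.Nullary.Decidable using (_⊎-dec_; _×-dec_; ¬?; dec-true)
open import Relation.Binary.PropositionalEquality as ≡ using (_≢_; refl; cong; subst)

All-at : ∀ {A : Set} {P : A → Set} {xs : List A} → All P xs → ∀ i → P (List.lookup xs i)
All-at ps i = All.lookup ps (∈-lookup i)

another-element : ∀ {m} → 2 ℕ.≤ m → (v : Fin m) → ∃ (v ≢_)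
another-element (s≤s (s≤s _)) zero    = suc zero , λ ()
another-element (s≤s (s≤s _)) (suc v) = zero , λ ()

module GraphTheory (G : Graph) where

  Vertex : Set
  Vertex = Fin (n G)

  infix 4 _~_

  _~_ : Vertex → Vertex → Set
  a ~ b = adj G a b ≡ true

  _~?_ : ∀ a b → Dec (a ~ b)
  a ~? b = adj G a b ≟ᵇ true

  ~-sym : ∀ {a b} → a ~ b → b ~ a
  ~-sym {a} {b} a~b = ≡.trans (Graph.sym G b a) a~b

  ~-irrefl : ∀ {a} → ¬ a ~ a
  ~-irrefl {a} a~a with ≡.trans (≡.sym a~a) (irrefl G a)
  ... | ()

  ~⇒≢ : ∀ {a b} → a ~ b → a ≢ b
  ~⇒≢ a~a refl = ~-irrefl a~a

  module _ {P : Vertex → Set} where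

    walk-start : ∀ {a b} → Walk G P a b → P a
    walk-start (here pa)     = pa
    walk-start (step pa _ _) = pa

    infixr 5 _++ʷ_
    _++ʷ_ : ∀ {a b c} → Walk G P a b → Walk G P b c → Walk G P a c
    here _         ++ʷ W = W
    step pa a~w V  ++ʷ W = step pa a~w (V ++ʷ W)

    reverseʷ : ∀ {a b} → Walk G P a b → Walk G P b a
    reverseʷ (here pa)       = here pa
    reverseʷ (step pa a~w W) = reverseʷ W ++ʷ step (walk-start W) (~-sym a~w) (here pa)

    vertices : ∀ {a b} → Walk G P a b → List Vertex
    vertices (here {a} _)       = a ∷ []
    vertices (step {a} _ _ W)   = a ∷ vertices W

    vertices-satisfy : ∀ {a b} (W : Walk G P a b) → All P (vertices W)
    vertices-satisfy (here pa)     = pa ∷ []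
    vertices-satisfy (step pa _ W) = pa ∷ vertices-satisfy W

    vertices-snoc : ∀ {a b} (W : Walk G P a b) → ∃ λ ms → vertices W ≡ ms ++ b ∷ []
    vertices-snoc (here _)       = [] , refl
    vertices-snoc (step {a} _ _ W) with vertices-snoc W
    ... | ms , eq = a ∷ ms , cong (a ∷_) eq

    vertices-ends : ∀ {a b} (W : Walk G P a b) → a ≢ b → ∃ λ ms → vertices W ≡ a ∷ ms ++ b ∷ []
    vertices-ends (here _)       a≢a = ⊥-elim (a≢a refl)
    vertices-ends (step _ _ W) _ with vertices-snoc W
    ... | ms , eq = ms , cong (_ ∷_) eq

  mapʷ : ∀ {P Q : Vertex → Set} {a b} → (∀ {z} → P z → Q z) → Walk G P a b → Walk G Q a b
  mapʷ f (here pa)       = here (f pa)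
  mapʷ f (step pa a~w W) = step (f pa) a~w (mapʷ f W)

  has-neighbour : TwoConnected G → ∀ v → ∃ (v ~_)
  has-neighbour (3≤n , connected , _) v with another-element (ℕ.≤-trans (s≤s (s≤s z≤n)) 3≤n) v
  ... | w , v≢w = first-edge v≢w (connected v w)
    where
    first-edge : ∀ {P a b} → a ≢ b → Walk G P a b → ∃ (a ~_)
    first-edge a≢a (here _)       = ⊥-elim (a≢a refl)
    first-edge _   (step _ a~w _) = _ , a~w

  AdjToHeadOnly : Vertex → List Vertex → Set
  AdjToHeadOnly z []       = ⊤
  AdjToHeadOnly z (y ∷ ys) = z ~ y × All (λ w → ¬ z ~ w) ys

  InducedPath : List Vertex → Set
  InducedPath []       = ⊤
  InducedPath (z ∷ zs) = All (z ≢_) zs × AdjToHeadOnly z zs × InducedPath zs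

  InducedWalk : (Vertex → Set) → Vertex → Vertex → Set
  InducedWalk Q a c = Σ (Walk G Q a c) (InducedPath ∘ vertices)

  Touches : Vertex → Vertex → Set
  Touches a z = a ≡ z ⊎ a ~ z

  touches? : ∀ a z → Dec (Touches a z)
  touches? a z = (a ≟ᶠ z) ⊎-dec (a ~? z)

  touches-start : ∀ {Q : Vertex → Set} {a b c} (W : Walk G Q b c) → Touches a b → Any (Touches a) (vertices W)
  touches-start (here _)     t = here t
  touches-start (step _ _ _) t = here t

  -- Prepending a to an induced walk that a touches: cut the walk at the last vertex a touches.
  prepend : ∀ {Q : Vertex → Set} {b c} a → Q a → (W : Walk G Q b c) → InducedPath (vertices W)
          → Any (Touches a) (vertices W) → InducedWalk Q a c
  prepend a qa W@(here _)  ind (here (inj₁ refl)) = W , ind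
  prepend a qa (here qb)   ind (here (inj₂ a~b))  = step qa a~b (here qb) , ~⇒≢ a~b ∷ [] , (a~b , []) , ind
  prepend a qa W@(step qb b~w V) ind@(_ , _ , indV) hit with Any.any? (touches? a) (vertices V)
  ... | yes later = prepend a qa V indV later
  ... | no none with hit
  ...   | there later        = ⊥-elim (none later)
  ...   | here (inj₁ refl)   = W , ind
  ...   | here (inj₂ a~b)    =
          step qa a~b W ,
          (~⇒≢ a~b ∷ All.map (λ ¬t a≡z → ¬t (inj₁ a≡z)) far) ,
          (a~b , All.map (λ ¬t a~z → ¬t (inj₂ a~z)) far) ,
          ind
    where far = ¬Any⇒All¬ (vertices V) none

  induced-path : ∀ {Q : Vertex → Set} {a c} → Walk G Q a c → InducedWalk Q a c
  induced-path (here qa)       = here qa , [] , tt , tt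
  induced-path (step qa a~w W) with induced-path W
  ... | W′ , ind = prepend _ qa W′ ind (touches-start W′ (inj₂ a~w))

  JoinedAtEnds : List Vertex → List Vertex → Set
  JoinedAtEnds []               ys = ⊤
  JoinedAtEnds (z ∷ [])         ys = AdjToHeadOnly z ys
  JoinedAtEnds (z ∷ zs@(_ ∷ _)) ys = All (λ w → ¬ z ~ w) ys × JoinedAtEnds zs ys

  joined-snoc : ∀ ms a ys → All (λ z → All (λ w → ¬ z ~ w) ys) ms → AdjToHeadOnly a ys
              → JoinedAtEnds (ms ++ a ∷ []) ys
  joined-snoc []               a ys []           a-ys = a-ys
  joined-snoc (z ∷ [])         a ys (z-ys ∷ [])   a-ys = z-ys , a-ys
  joined-snoc (z ∷ ms@(_ ∷ _)) a ys (z-ys ∷ rest) a-ys = z-ys , joined-snoc ms a ys rest a-ys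

  inducedPath-++ : ∀ xs ys → InducedPath xs → InducedPath ys → All (λ z → All (z ≢_) ys) xs
                 → JoinedAtEnds xs ys → InducedPath (xs ++ ys)
  inducedPath-++ []               ys _ indY _ _ = indY
  inducedPath-++ (z ∷ [])         ys _ indY (z∉ys ∷ []) z-ys = z∉ys , z-ys , indY
  inducedPath-++ (z ∷ zs@(_ ∷ _)) ys (z∉zs , (z~y , far) , indZ) indY (z∉ys ∷ disjoint) (z-ys , joined) =
    ++⁺ z∉zs z∉ys , (z~y , ++⁺ far z-ys) , inducedPath-++ zs ys indZ indY disjoint joined

  distinct-from-last : ∀ ms l → InducedPath (ms ++ l ∷ []) → All (_≢ l) ms
  distinct-from-last []       l _                 = []
  distinct-from-last (z ∷ ms) l (z∉ , _ , indMs) = All.head (++⁻ʳ ms z∉) ∷ distinct-from-last ms l indMs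

  AdjToLastOnly : Vertex → List Vertex → Set
  AdjToLastOnly x []               = ⊥
  AdjToLastOnly x (l ∷ [])         = x ~ l
  AdjToLastOnly x (z ∷ zs@(_ ∷ _)) = ¬ x ~ z × AdjToLastOnly x zs

  adjToLastOnly-++ : ∀ {x} zs ys → All (λ w → ¬ x ~ w) zs → AdjToLastOnly x ys → AdjToLastOnly x (zs ++ ys)
  adjToLastOnly-++ []               ys       _          last = last
  adjToLastOnly-++ (z ∷ [])         (_ ∷ _)  (¬x~z ∷ []) last = ¬x~z , last
  adjToLastOnly-++ (z ∷ zs@(_ ∷ _)) ys       (¬x~z ∷ far) last = ¬x~z , adjToLastOnly-++ zs ys far last

  AdjToEndsOnly : Vertex → List Vertex → Set
  AdjToEndsOnly x []      = ⊥
  AdjToEndsOnly x (h ∷ t) = x ~ h × AdjToLastOnly x t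

  adjToEndsOnly-++ : ∀ {x} zs ys → zs ≢ [] → AdjToHeadOnly x zs → AdjToLastOnly x ys → AdjToEndsOnly x (zs ++ ys)
  adjToEndsOnly-++ []       ys nonempty _           _    = ⊥-elim (nonempty refl)
  adjToEndsOnly-++ (z ∷ zs) ys _        (x~z , far) last = x~z , adjToLastOnly-++ zs ys far last

  Consecutive : ∀ {m} → Fin m → Fin m → Set
  Consecutive i j = toℕ j ≡ suc (toℕ i) ⊎ toℕ i ≡ suc (toℕ j)

  adjToHeadOnly-at : ∀ {z} ys → AdjToHeadOnly z ys → ∀ j → z ~ List.lookup ys j ⇔ toℕ j ≡ 0
  adjToHeadOnly-at (y ∷ ys) (z~y , _) zero    = mk⇔ (λ _ → refl) (λ _ → z~y)
  adjToHeadOnly-at (y ∷ ys) (_ , far) (suc j) = mk⇔ (λ z~ → ⊥-elim (All-at far j z~)) (λ ())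

  adjToLastOnly-at : ∀ {x} t → AdjToLastOnly x t → ∀ j → x ~ List.lookup t j ⇔ suc (toℕ j) ≡ length t
  adjToLastOnly-at (l ∷ [])         x~l        zero    = mk⇔ (λ _ → refl) (λ _ → x~l)
  adjToLastOnly-at (z ∷ _ ∷ _)      (¬x~z , _) zero    = mk⇔ (⊥-elim ∘ ¬x~z) (λ ())
  adjToLastOnly-at (z ∷ zs@(_ ∷ _)) (_ , last) (suc j) = mk⇔ (cong suc ∘ to) (from ∘ ℕ.suc-injective)
    where open Equivalence (adjToLastOnly-at zs last j)

  consecutive-suc : ∀ {m} {i j : Fin m} → Consecutive (suc i) (suc j) ⇔ Consecutive i j
  consecutive-suc = mk⇔ (⊎-map ℕ.suc-injective ℕ.suc-injective) (⊎-map (cong suc) (cong suc))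

  inducedPath-adjacency : ∀ R → InducedPath R → ∀ i j → List.lookup R i ~ List.lookup R j ⇔ Consecutive i j
  inducedPath-adjacency (z ∷ zs) _ zero zero =
    mk⇔ (⊥-elim ∘ ~-irrefl) λ { (inj₁ ()) ; (inj₂ ()) }
  inducedPath-adjacency (z ∷ zs) (_ , head , _) zero (suc j) =
    mk⇔ (inj₁ ∘ cong suc ∘ to) λ { (inj₁ e) → from (ℕ.suc-injective e) ; (inj₂ ()) }
    where open Equivalence (adjToHeadOnly-at zs head j)
  inducedPath-adjacency (z ∷ zs) (_ , head , _) (suc i) zero =
    mk⇔ (inj₂ ∘ cong suc ∘ to ∘ ~-sym) λ { (inj₁ ()) ; (inj₂ e) → ~-sym (from (ℕ.suc-injective e)) }
    where open Equivalence (adjToHeadOnly-at zs head i)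
  inducedPath-adjacency (z ∷ zs) (_ , _ , ind) (suc i) (suc j) =
    mk⇔ (Equivalence.from consecutive-suc ∘ to) (from ∘ Equivalence.to consecutive-suc)
    where open Equivalence (inducedPath-adjacency zs ind i j)

  inducedPath-injective : ∀ R → InducedPath R → ∀ {i j} → List.lookup R i ≡ List.lookup R j → i ≡ j
  inducedPath-injective (z ∷ zs) _           {zero}  {zero}  _ = refl
  inducedPath-injective (z ∷ zs) (z∉zs , _)  {zero}  {suc j} e = ⊥-elim (All-at z∉zs j e)
  inducedPath-injective (z ∷ zs) (z∉zs , _)  {suc i} {zero}  e = ⊥-elim (All-at z∉zs i (≡.sym e))
  inducedPath-injective (z ∷ zs) (_ , _ , ind) {suc i} {suc j} e = cong suc (inducedPath-injective zs ind e)

  cycAdj-sym : ∀ k {i j} → CycAdj G k i j → CycAdj G k j i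
  cycAdj-sym k (inj₁ e)               = inj₂ (inj₁ e)
  cycAdj-sym k (inj₂ (inj₁ e))        = inj₁ e
  cycAdj-sym k (inj₂ (inj₂ (inj₁ e))) = inj₂ (inj₂ (inj₂ e))
  cycAdj-sym k (inj₂ (inj₂ (inj₂ e))) = inj₂ (inj₂ (inj₁ e))

  close-cycle : ∀ x R → InducedPath R → All (x ≢_) R → AdjToEndsOnly x R → InducedCycle G (suc (length R))
  close-cycle x R@(h ∷ t) indR x∉R (x~h , lastOnly) = c , injective , adjacency
    where
    k = suc (length R)

    c : Fin k → Vertex
    c = List.lookup (x ∷ R)

    injective : ∀ {i j} → c i ≡ c j → i ≡ j
    injective {zero}  {zero}  _ = refl
    injective {zero}  {suc j} e = ⊥-elim (All-at x∉R j e)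
    injective {suc i} {zero}  e = ⊥-elim (All-at x∉R i (≡.sym e))
    injective {suc i} {suc j} e = cong suc (inducedPath-injective R indR e)

    x-row : ∀ j → x ~ c j ⇔ CycAdj G k zero j
    x-row zero =
      mk⇔ (⊥-elim ∘ ~-irrefl)
          λ { (inj₁ ()) ; (inj₂ (inj₁ ())) ; (inj₂ (inj₂ (inj₁ (_ , ())))) ; (inj₂ (inj₂ (inj₂ (_ , ())))) }
    x-row (suc zero) = mk⇔ (λ _ → inj₁ refl) (λ _ → x~h)
    x-row (suc (suc j)) =
      mk⇔ (λ x~c → inj₂ (inj₂ (inj₁ (refl , cong suc (to x~c)))))
          λ { (inj₁ ()) ; (inj₂ (inj₁ ())) ; (inj₂ (inj₂ (inj₁ (_ , e)))) → from (ℕ.suc-injective e)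
            ; (inj₂ (inj₂ (inj₂ (() , _)))) }
      where open Equivalence (adjToLastOnly-at t lastOnly j)

    consecutive⇔cycAdj : ∀ {i j : Fin (length R)} → Consecutive i j ⇔ CycAdj G k (suc i) (suc j)
    consecutive⇔cycAdj =
      mk⇔ (⊎-map (cong suc) (inj₁ ∘ cong suc))
          λ { (inj₁ e) → inj₁ (ℕ.suc-injective e) ; (inj₂ (inj₁ e)) → inj₂ (ℕ.suc-injective e)
            ; (inj₂ (inj₂ (inj₁ (() , _)))) ; (inj₂ (inj₂ (inj₂ (() , _)))) }

    adjacency : ∀ i j → c i ~ c j ⇔ CycAdj G k i j
    adjacency zero    j       = x-row j
    adjacency (suc i) zero    = mk⇔ (cycAdj-sym k ∘ to ∘ ~-sym) (~-sym ∘ from ∘ cycAdj-sym k)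
      where open Equivalence (x-row (suc i))
    adjacency (suc i) (suc j) =
      mk⇔ (Equivalence.to consecutive⇔cycAdj ∘ to) (from ∘ Equivalence.from consecutive⇔cycAdj)
      where open Equivalence (inducedPath-adjacency R indR i j)

  AtMostOneNeighbourIn : Subset (n G) → Set
  AtMostOneNeighbourIn D = ∀ {z a b} → z ∉ D → a ∈ D → b ∈ D → z ~ a → z ~ b → a ≡ b

  -- D induces a connected subgraph: each of its vertices reaches r inside D.
  ReachesWithin : Subset (n G) → Vertex → Set
  ReachesWithin D r = ∀ {a} → a ∈ D → Walk G (_∈ D) a r

  NoNeighbourIn : Subset (n G) → Vertex → Set
  NoNeighbourIn D z = ∀ {b} → b ∈ D → ¬ z ~ b

-- The graph-theoretic core: in a 2-connected chordal graph, a connected vertex set D with at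
-- least two vertices such that no outside vertex has two neighbours in D is the whole vertex set.
-- Otherwise one finds x ∈ D and an "ear": a path outside D from a neighbour of x to a neighbour
-- of some a ∈ D, a ≠ x, without further edges into D. Together with an induced path from x to a
-- inside D it forms an induced cycle of length at least four.
module Absorption (G : Graph) (tc : TwoConnected G) (chordal : Chordal G)
                  (D : Subset (n G)) (unique : GraphTheory.AtMostOneNeighbourIn G D) where
  open GraphTheory G

  EarVertex : Vertex → Vertex → Vertex → Set
  EarVertex e s z = z ∉ D × (z ≡ e ⊎ z ≡ s ⊎ NoNeighbourIn D z)

  record Ear (x : Vertex) : Set where
    field
      e s a : Vertex
      path  : Walk G (EarVertex e s) e s
      e~a   : e ~ a
      a∈D   : a ∈ D
      a≢x   : a ≢ x
      s~x   : s ~ x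

  module EarCycle {x e s a : Vertex} (x∈D : x ∈ D) (a∈D : a ∈ D) (e~a : e ~ a) (a≢x : a ≢ x) (s~x : s ~ x) where

    -- By uniqueness of D-neighbours, the only edges between the ear and D are e ~ a and s ~ x.
    attachments : ∀ {z} → EarVertex e s z → ∀ {b} → b ∈ D → z ~ b → (z ≡ e × b ≡ a) ⊎ (z ≡ s × b ≡ x)
    attachments (z∉D , inj₁ refl)        b∈D z~b = inj₁ (refl , unique z∉D b∈D a∈D z~b e~a)
    attachments (z∉D , inj₂ (inj₁ refl)) b∈D z~b = inj₂ (refl , unique z∉D b∈D x∈D z~b s~x)
    attachments (_   , inj₂ (inj₂ none)) b∈D z~b = ⊥-elim (none b∈D z~b)

    inside-far : ∀ {z w} → z ∈ D → z ≢ a → z ≢ x → EarVertex e s w → ¬ z ~ w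
    inside-far z∈D z≢a z≢x onW z~w with attachments onW z∈D (~-sym z~w)
    ... | inj₁ (_ , z≡a) = z≢a z≡a
    ... | inj₂ (_ , z≡x) = z≢x z≡x

    a-far : ∀ {w} → w ≢ e → EarVertex e s w → ¬ a ~ w
    a-far w≢e onW a~w with attachments onW a∈D (~-sym a~w)
    ... | inj₁ (w≡e , _) = w≢e w≡e
    ... | inj₂ (_ , a≡x) = a≢x a≡x

    x-far : ∀ {w} → w ≢ s → EarVertex e s w → ¬ x ~ w
    x-far w≢s onW x~w with attachments onW x∈D (~-sym x~w)
    ... | inj₁ (_ , x≡a) = a≢x (≡.sym x≡a)
    ... | inj₂ (w≡s , _) = w≢s w≡s

    outside : ∀ {z w} → z ∈ D → EarVertex e s w → z ≢ w
    outside z∈D (w∉D , _) z≡w = w∉D (subst (_∈ D) z≡w z∈D)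

    -- The cycle x, ms, a, e, es, s is induced and has length at least four.
    glue : ∀ ms es → InducedPath (x ∷ ms ++ a ∷ []) → All (_∈ D) (ms ++ a ∷ [])
         → InducedPath (e ∷ es ++ s ∷ []) → All (EarVertex e s) (e ∷ es ++ s ∷ []) → ⊥
    glue ms es (x∉F , x-head , indF) inF indE@(e∉E , _) onE =
      chordal (suc (length R)) long (close-cycle x R indR x∉R x-ends)
      where
      F = ms ++ a ∷ []
      E = e ∷ es ++ s ∷ []
      R = F ++ E

      ms-far : All (λ z → All (λ w → ¬ z ~ w) E) ms
      ms-far = All.zipWith (λ { (z∈D , z≢a , x≢z) → All.map (inside-far z∈D z≢a (≡.≢-sym x≢z)) onE })
                           (++⁻ˡ ms inF , All.zip (distinct-from-last ms a indF , ++⁻ˡ ms x∉F))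

      a-head : AdjToHeadOnly a E
      a-head = ~-sym e~a , All.zipWith (λ (e≢w , onW) → a-far (≡.≢-sym e≢w) onW) (e∉E , All.tail onE)

      x-last : AdjToLastOnly x E
      x-last = adjToLastOnly-++ (e ∷ es) (s ∷ [])
                 (All.zipWith (λ (w≢s , onW) → x-far w≢s onW) (distinct-from-last (e ∷ es) s indE , ++⁻ˡ (e ∷ es) onE))
                 (~-sym s~x)

      indR : InducedPath R
      indR = inducedPath-++ F E indF indE (All.map (λ z∈D → All.map (outside z∈D) onE) inF)
                            (joined-snoc ms a E ms-far a-head)

      x∉R : All (x ≢_) R
      x∉R = ++⁺ x∉F (All.map (outside x∈D) onE)

      x-ends : AdjToEndsOnly x R
      x-ends = adjToEndsOnly-++ F E (λ F≡[] → case ++-conicalʳ ms (a ∷ []) F≡[] of λ ()) x-head x-last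

      long : 4 ℕ.≤ suc (length R)
      long = s≤s (subst (3 ℕ.≤_) (≡.sym (length-++ F))
                        (ℕ.+-mono-≤ (length-++-≤ʳ (a ∷ []) {ms}) (s≤s (length-++-≤ʳ (s ∷ []) {es}))))

  no-ear : ∀ {r x} → ReachesWithin D r → x ∈ D → Ear x → ⊥
  no-ear {x = x} connected x∈D ear = chordless (induced-path inside) (induced-path path)
    where
    open Ear ear
    open EarCycle x∈D a∈D e~a a≢x s~x

    inside : Walk G (_∈ D) x a
    inside = connected x∈D ++ʷ reverseʷ (connected a∈D)

    e≢s : e ≢ s
    e≢s refl = a≢x (unique (proj₁ (walk-start path)) a∈D x∈D e~a s~x)

    chordless : InducedWalk (_∈ D) x a → InducedWalk (EarVertex e s) e s → ⊥
    chordless (F , indF) (E , indE) with vertices-ends F (a≢x ∘ ≡.sym) | vertices-ends E e≢s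
    ... | ms , eqF | es , eqE =
      glue ms es (subst InducedPath eqF indF) (All.tail (subst (All (_∈ D)) eqF (vertices-satisfy F)))
                 (subst InducedPath eqE indE) (subst (All (EarVertex e s)) eqE (vertices-satisfy E))

  -- Walking from a vertex whose only D-neighbour is x, avoiding x, into D produces an ear at x.
  module EarSearch {x : Vertex} (x∈D : x ∈ D) where

    OnlyNeighbourIsX : Vertex → Set
    OnlyNeighbourIsX w = ∀ {b} → b ∈ D → w ~ b → b ≡ x

    only-x? : ∀ w → OnlyNeighbourIsX w ⊎ ∃ λ b → b ∈ D × b ≢ x × w ~ b
    only-x? w with any? (λ b → (b ∈? D) ×-dec ¬? (b ≟ᶠ x) ×-dec (w ~? b))
    ... | yes other = inj₂ other
    ... | no none   = inj₁ only
      where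
      only : OnlyNeighbourIsX w
      only {b} b∈D w~b with b ≟ᶠ x
      ... | yes b≡x = b≡x
      ... | no  b≢x = ⊥-elim (none (b , b∈D , b≢x , w~b))

    TailVertex : Vertex → Vertex → Set
    TailVertex s z = z ∉ D × (z ≡ s ⊎ NoNeighbourIn D z)

    -- Invariant: P runs from the current vertex w back to the last visited neighbour s of x,
    -- through vertices without D-neighbours.
    find : ∀ {w s t} → s ∉ D → s ~ x → Walk G (TailVertex s) w s → OnlyNeighbourIsX w
         → Walk G (_≢ x) w t → t ∈ D → Ear x
    find _ _ P _ (here _) t∈D = ⊥-elim (proj₁ (walk-start P) t∈D)
    find {w} {s} s∉D s~x P only (step {w = w₁} _ w~w₁ rest) t∈D with w₁ ∈? D
    ... | yes w₁∈D = ⊥-elim (walk-start rest (only w₁∈D w~w₁))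
    ... | no  w₁∉D with only-x? w₁
    ...   | inj₂ (b , b∈D , b≢x , w₁~b) =
            record { path = step (w₁∉D , inj₁ refl) (~-sym w~w₁) (mapʷ widen P)
                   ; e~a = w₁~b ; a∈D = b∈D ; a≢x = b≢x ; s~x = s~x }
      where
      widen : ∀ {z} → TailVertex s z → EarVertex w₁ s z
      widen (z∉D , inj₁ z≡s) = z∉D , inj₂ (inj₁ z≡s)
      widen (z∉D , inj₂ none) = z∉D , inj₂ (inj₂ none)
    ...   | inj₁ only₁ with w₁ ~? x
    ...     | yes w₁~x = find w₁∉D w₁~x (here (w₁∉D , inj₁ refl)) only₁ rest t∈D
    ...     | no ¬w₁~x = find s∉D s~x (step (w₁∉D , inj₂ none) (~-sym w~w₁) P) only₁ rest t∈D
      where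
      none : NoNeighbourIn D w₁
      none b∈D w₁~b = ¬w₁~x (subst (w₁ ~_) (only₁ b∈D w₁~b) w₁~b)

  boundary-edge : ∀ {a b} → Walk G (λ _ → ⊤) a b → a ∉ D → b ∈ D → ∃ λ c → ∃ λ x → c ∉ D × x ∈ D × c ~ x
  boundary-edge (here _) a∉D a∈D = ⊥-elim (a∉D a∈D)
  boundary-edge (step {u = a} {w = w} _ a~w rest) a∉D b∈D with w ∈? D
  ... | yes w∈D = a , w , a∉D , w∈D , a~w
  ... | no  w∉D = boundary-edge rest w∉D b∈D

  -- The absorption lemma. Leaving D from an outside vertex z gives an edge c ~ x into D; a walk
  -- from c to another vertex of D avoiding x (2-connectivity) contains an ear at x.
  absorbs-all : ∀ {r r′} → ReachesWithin D r → r ∈ D → r′ ∈ D → r ≢ r′ → ∀ z → z ∈ D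
  absorbs-all {r} {r′} connected r∈D r′∈D r≢r′ z with z ∈? D
  ... | yes z∈D = z∈D
  ... | no  z∉D with boundary-edge (proj₁ (proj₂ tc) z r) z∉D r∈D
  ...   | c , x , c∉D , x∈D , c~x = ⊥-elim (no-ear connected x∈D ear)
    where
    open EarSearch x∈D

    other : ∃ λ t → t ∈ D × t ≢ x
    other with r ≟ᶠ x
    ... | yes r≡x = r′ , r′∈D , λ r′≡x → r≢r′ (≡.trans r≡x (≡.sym r′≡x))
    ... | no  r≢x = r , r∈D , r≢x

    c≢x : c ≢ x
    c≢x c≡x = c∉D (subst (_∈ D) (≡.sym c≡x) x∈D)

    ear : Ear x
    ear = find c∉D c~x (here (c∉D , inj₁ refl)) (λ b∈D c~b → unique c∉D b∈D x∈D c~b c~x)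
               (proj₂ (proj₂ tc) x c (proj₁ other) c≢x (proj₂ (proj₂ other))) (proj₁ (proj₂ other))

member⇒nonempty : ∀ {m} {p : Subset m} {x} → x ∈ p → 1 ℕ.≤ ∣ p ∣
member⇒nonempty {p = p} x∈p = ℕ.≤-trans (s≤s z≤n) (x∈p⇒∣p-x∣<∣p∣ {p = p} x∈p)

two-members : ∀ {m} {p : Subset m} {x y} → x ≢ y → x ∈ p → y ∈ p → 2 ℕ.≤ ∣ p ∣
two-members {p = p} {x} x≢y x∈p y∈p =
  ℕ.≤-trans (s≤s (member⇒nonempty {p = p - x} (x∈p∧x≢y⇒x∈p-y y∈p (≡.≢-sym x≢y)))) (x∈p⇒∣p-x∣<∣p∣ {p = p} x∈p)

∣p∪q∣≤∣p∣+∣q∣ : ∀ {m} (p q : Subset m) → ∣ p ∪ q ∣ ℕ.≤ ∣ p ∣ + ∣ q ∣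
∣p∪q∣≤∣p∣+∣q∣ Vec.[]              Vec.[]              = z≤n
∣p∪q∣≤∣p∣+∣q∣ (true Vec.∷ p)      (b Vec.∷ q)         =
  s≤s (ℕ.≤-trans (∣p∪q∣≤∣p∣+∣q∣ p q) (ℕ.+-monoʳ-≤ ∣ p ∣ (∣p∣≤∣x∷p∣ b q)))
∣p∪q∣≤∣p∣+∣q∣ (false Vec.∷ p)     (true Vec.∷ q)      =
  subst (suc ∣ p ∪ q ∣ ℕ.≤_) (≡.sym (ℕ.+-suc ∣ p ∣ ∣ q ∣)) (s≤s (∣p∪q∣≤∣p∣+∣q∣ p q))
∣p∪q∣≤∣p∣+∣q∣ (false Vec.∷ p)     (false Vec.∷ q)     = ∣p∪q∣≤∣p∣+∣q∣ p q

∣⁅x⁆∪⁅y⁆∣≡2 : ∀ {m} {x y : Fin m} → x ≢ y → ∣ ⁅ x ⁆ ∪ ⁅ y ⁆ ∣ ≡ 2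
∣⁅x⁆∪⁅y⁆∣≡2 {x = x} {y} x≢y = ℕ.≤-antisym
  (subst (∣ ⁅ x ⁆ ∪ ⁅ y ⁆ ∣ ℕ.≤_) (≡.cong₂ _+_ (∣⁅x⁆∣≡1 x) (∣⁅x⁆∣≡1 y)) (∣p∪q∣≤∣p∣+∣q∣ ⁅ x ⁆ ⁅ y ⁆))
  (two-members x≢y (x∈p∪q⁺ (inj₁ (x∈⁅x⁆ x))) (x∈p∪q⁺ (inj₂ (x∈⁅x⁆ y))))

module Activation (G : Graph) (θ : Threshold G) where
  open GraphTheory G

  round : Subset (n G) → Subset (n G)
  round = activationStep G θ

  activeNeighbours : Vertex → Subset (n G) → ℕ
  activeNeighbours w S = ∣ neighbourhood G w ∩ S ∣

  round-lookup : ∀ S w → Vec.lookup (round S) w ≡ (Vec.lookup S w ∨ does (θ w ℤ.≤? + activeNeighbours w S))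
  round-lookup S w = lookup∘tabulate _ w

  round-inflationary : ∀ {S} → S ⊆ round S
  round-inflationary {S} {w} w∈S =
    lookup⇒[]= w (round S)
      (≡.trans (round-lookup S w) (cong (_∨ does (θ w ℤ.≤? + activeNeighbours w S)) ([]=⇒lookup w∈S)))

  round-activates : ∀ {S w} → θ w ≤ + activeNeighbours w S → w ∈ round S
  round-activates {S} {w} reached =
    lookup⇒[]= w (round S) (≡.trans (round-lookup S w)
      (≡.trans (cong (Vec.lookup S w ∨_) (dec-true (θ w ℤ.≤? _) reached)) (∨-zeroʳ _)))

  round-only : ∀ {S w} → w ∈ round S → w ∈ S ⊎ θ w ≤ + activeNeighbours w S
  round-only {S} {w} w∈ with θ w ℤ.≤? + activeNeighbours w S | round-lookup S w
  ... | yes reached | _  = inj₂ reached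
  ... | no  _       | eq = inj₁ (lookup⇒[]= w S (≡.trans (≡.sym (≡.trans eq (∨-identityʳ _))) ([]=⇒lookup w∈)))

  neighbour-counted : ∀ {S w a} → w ~ a → a ∈ S → a ∈ neighbourhood G w ∩ S
  neighbour-counted {w = w} {a} w~a a∈S =
    x∈p∩q⁺ (lookup⇒[]= a (neighbourhood G w) (≡.trans (lookup∘tabulate (adj G w) a) w~a) , a∈S)

  iterate-suc : ∀ f t S → iterate G (suc t) f S ≡ iterate G t f (f S)
  iterate-suc f ℕ.zero  S = refl
  iterate-suc f (suc t) S = cong f (iterate-suc f t S)

  iterate-fixed : ∀ {f S} → f S ≡ S → ∀ t → iterate G t f S ≡ S
  iterate-fixed fixed ℕ.zero  = refl
  iterate-fixed {f} fixed (suc t) = ≡.trans (cong f (iterate-fixed fixed t)) fixed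

module Percolation (G : Graph) (tc : TwoConnected G) (chordal : Chordal G)
                   (θ : Threshold G) (θ≤2 : ∀ v → θ v ≤ + 2) where
  open GraphTheory G
  open Activation G θ

  DoublyAttached : Subset (n G) → Set
  DoublyAttached D = ∃ λ z → ∃ λ a → ∃ λ b → z ∉ D × a ∈ D × b ∈ D × a ≢ b × z ~ a × z ~ b

  doublyAttached? : ∀ D → Dec (DoublyAttached D)
  doublyAttached? D = any? λ z → any? λ a → any? λ b →
    ¬? (z ∈? D) ×-dec (a ∈? D) ×-dec (b ∈? D) ×-dec ¬? (a ≟ᶠ b) ×-dec (z ~? a) ×-dec (z ~? b)

  full-or-doublyAttached : ∀ {D r r′} → ReachesWithin D r → r ∈ D → r′ ∈ D → r ≢ r′
                         → (∀ z → z ∈ D) ⊎ DoublyAttached D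
  full-or-doublyAttached {D} connected r∈D r′∈D r≢r′ with doublyAttached? D
  ... | yes attached = inj₂ attached
  ... | no  none     = inj₁ (Absorption.absorbs-all G tc chordal D unique connected r∈D r′∈D r≢r′)
    where
    unique : AtMostOneNeighbourIn D
    unique {z} {a} {b} z∉D a∈D b∈D z~a z~b with a ≟ᶠ b
    ... | yes a≡b = a≡b
    ... | no  a≢b = ⊥-elim (none (z , a , b , z∉D , a∈D , b∈D , a≢b , z~a , z~b))

  module FromEdge {u v : Vertex} (u~v : u ~ v) where

    record Cluster (S : Subset (n G)) : Set where
      field
        D         : Subset (n G)
        D⊆S       : D ⊆ S
        u∈D       : u ∈ D
        v∈D       : v ∈ D
        connected : ReachesWithin D u

    open Cluster

    edge : Subset (n G)
    edge = ⁅ u ⁆ ∪ ⁅ v ⁆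

    u∈edge : u ∈ edge
    u∈edge = x∈p∪q⁺ (inj₁ (x∈⁅x⁆ u))

    v∈edge : v ∈ edge
    v∈edge = x∈p∪q⁺ (inj₂ (x∈⁅x⁆ v))

    edge-cluster : ∀ {S} → u ∈ S → v ∈ S → Cluster S
    edge-cluster {S} u∈S v∈S = record
      { D = edge ; D⊆S = edge⊆S ; u∈D = u∈edge ; v∈D = v∈edge ; connected = edge-connected }
      where
      edge⊆S : edge ⊆ S
      edge⊆S w∈ with x∈p∪q⁻ ⁅ u ⁆ ⁅ v ⁆ w∈
      ... | inj₁ w∈⁅u⁆ = subst (_∈ S) (≡.sym (x∈⁅y⁆⇒x≡y u w∈⁅u⁆)) u∈S
      ... | inj₂ w∈⁅v⁆ = subst (_∈ S) (≡.sym (x∈⁅y⁆⇒x≡y v w∈⁅v⁆)) v∈S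

      edge-connected : ReachesWithin edge u
      edge-connected w∈ with x∈p∪q⁻ ⁅ u ⁆ ⁅ v ⁆ w∈
      ... | inj₁ w∈⁅u⁆ rewrite x∈⁅y⁆⇒x≡y u w∈⁅u⁆ = here u∈edge
      ... | inj₂ w∈⁅v⁆ rewrite x∈⁅y⁆⇒x≡y v w∈⁅v⁆ = step v∈edge (~-sym u~v) (here u∈edge)

    persist : ∀ {S} → Cluster S → Cluster (round S)
    persist C = record
      { D = D C ; D⊆S = λ w∈D → round-inflationary (D⊆S C w∈D) ; u∈D = u∈D C ; v∈D = v∈D C
      ; connected = connected C }

    -- A doubly attached vertex joins the cluster one round later (its threshold is at most 2).
    grow : ∀ {S} (C : Cluster S) → DoublyAttached (D C) → Σ (Cluster (round S)) λ C′ → suc ∣ D C ∣ ℕ.≤ ∣ D C′ ∣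
    grow {S} C (z , a , b , z∉D , a∈D , b∈D , a≢b , z~a , z~b) =
      record { D = D′ ; D⊆S = D′⊆roundS ; u∈D = old (u∈D C) ; v∈D = old (v∈D C) ; connected = connected′ } ,
      p⊂q⇒∣p∣<∣q∣ (old , z , z∈D′ , z∉D)
      where
      D′ = D C ∪ ⁅ z ⁆

      old : D C ⊆ D′
      old w∈D = x∈p∪q⁺ (inj₁ w∈D)

      z∈D′ : z ∈ D′
      z∈D′ = x∈p∪q⁺ (inj₂ (x∈⁅x⁆ z))

      z-activated : z ∈ round S
      z-activated = round-activates (ℤ.≤-trans (θ≤2 z) (+≤+ (two-members a≢b
                      (neighbour-counted z~a (D⊆S C a∈D)) (neighbour-counted z~b (D⊆S C b∈D)))))

      D′⊆roundS : D′ ⊆ round S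
      D′⊆roundS w∈ with x∈p∪q⁻ (D C) ⁅ z ⁆ w∈
      ... | inj₁ w∈D    = round-inflationary (D⊆S C w∈D)
      ... | inj₂ w∈⁅z⁆ = subst (_∈ round S) (≡.sym (x∈⁅y⁆⇒x≡y z w∈⁅z⁆)) z-activated

      connected′ : ReachesWithin D′ u
      connected′ w∈ with x∈p∪q⁻ (D C) ⁅ z ⁆ w∈
      ... | inj₁ w∈D = mapʷ old (connected C w∈D)
      ... | inj₂ w∈⁅z⁆ rewrite x∈⁅y⁆⇒x≡y z w∈⁅z⁆ = step z∈D′ z~a (mapʷ old (connected C a∈D))

    spread : ∀ {S} → u ∈ S → v ∈ S → ∀ t → Σ (Cluster (iterate G t round S)) λ C → (∀ z → z ∈ D C) ⊎ t + 2 ℕ.≤ ∣ D C ∣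
    spread u∈S v∈S ℕ.zero = edge-cluster u∈S v∈S , inj₂ (two-members (~⇒≢ u~v) (u∈D C₀) (v∈D C₀))
      where C₀ = edge-cluster u∈S v∈S
    spread u∈S v∈S (suc t) with spread u∈S v∈S t
    ... | C , size with full-or-doublyAttached (connected C) (u∈D C) (v∈D C) (~⇒≢ u~v)
    ...   | inj₁ full = persist C , inj₁ full
    ...   | inj₂ attached@(z , _ , _ , z∉D , _) with size | grow C attached
    ...     | inj₁ full | _         = ⊥-elim (z∉D (full z))
    ...     | inj₂ big  | C′ , grew = C′ , inj₂ (ℕ.≤-trans (s≤s big) grew)

    percolates : ∀ {S} → u ∈ S → v ∈ S → ∀ t → n G ℕ.≤ t + 1 → iterate G t round S ≡ Subset.⊤
    percolates u∈S v∈S t late with spread u∈S v∈S t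
    ... | C , inj₁ full = ⊆-antisym ⊆⊤ (λ {z} _ → D⊆S C (full z))
    ... | C , inj₂ big  = ⊥-elim (ℕ.<-irrefl refl (ℕ.+-cancelˡ-≤ t 2 1 (ℕ.≤-trans big (ℕ.≤-trans (∣p∣≤n (D C)) late))))

  edge-seed : ∀ {u v} → u ~ v → closure G θ (⁅ u ⁆ ∪ ⁅ v ⁆) ≡ Subset.⊤
  edge-seed u~v = percolates u∈edge v∈edge (n G) (ℕ.m≤m+n (n G) 1)
    where open FromEdge u~v

  -- A single neighbour w of a vertex v of threshold at most one activates v in the first round;
  -- from then on the edge vw percolates.
  weak-vertex-seed : ∀ {v w} → θ v ≤ + 1 → v ~ w → closure G θ ⁅ w ⁆ ≡ Subset.⊤
  weak-vertex-seed {v} {w} θv≤1 v~w = begin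
    iterate G N round ⁅ w ⁆               ≡⟨ cong (λ t → iterate G t round ⁅ w ⁆) (≡.sym N≡1+[N∸1]) ⟩
    iterate G (suc (N ∸ 1)) round ⁅ w ⁆   ≡⟨ iterate-suc round (N ∸ 1) ⁅ w ⁆ ⟩
    iterate G (N ∸ 1) round (round ⁅ w ⁆) ≡⟨ FromEdge.percolates (~-sym v~w) w-active v-active (N ∸ 1) late ⟩
    Subset.⊤                              ∎
    where
    open ≡.≡-Reasoning
    N = n G

    1≤N : 1 ℕ.≤ N
    1≤N = ℕ.≤-trans (s≤s z≤n) (proj₁ tc)

    N≡1+[N∸1] : suc (N ∸ 1) ≡ N
    N≡1+[N∸1] = ℕ.m+[n∸m]≡n 1≤N

    late : N ℕ.≤ N ∸ 1 + 1
    late = ℕ.≤-reflexive (≡.sym (ℕ.m∸n+n≡m 1≤N))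

    w-active : w ∈ round ⁅ w ⁆
    w-active = round-inflationary (x∈⁅x⁆ w)

    v-active : v ∈ round ⁅ w ⁆
    v-active = round-activates (ℤ.≤-trans θv≤1 (+≤+ (member⇒nonempty (neighbour-counted v~w (x∈⁅x⁆ w)))))

module ThresholdTwo (G : Graph) (θ : Threshold G) (θ≡2 : ∀ v → θ v ≡ + 2) where
  open Activation G θ

  small-set-stuck : ∀ {S} → ∣ S ∣ ℕ.≤ 1 → round S ≡ S
  small-set-stuck {S} small = ⊆-antisym no-new round-inflationary
    where
    no-new : round S ⊆ S
    no-new {w} w∈ with round-only w∈
    ... | inj₁ w∈S    = w∈S
    ... | inj₂ reached = ⊥-elim (ℕ.<-irrefl refl (ℕ.≤-trans two≤count (ℕ.≤-trans (∣p∩q∣≤∣q∣ (neighbourhood G w) S) small)))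
      where
      two≤count : 2 ℕ.≤ activeNeighbours w S
      two≤count = ℤ.drop‿+≤+ (subst (_≤ + activeNeighbours w S) (θ≡2 w) reached)

  seeds-are-large : ∀ {S} → 3 ℕ.≤ n G → closure G θ S ≡ Subset.⊤ → 2 ℕ.≤ ∣ S ∣
  seeds-are-large {S} 3≤n full with 2 ℕ.≤? ∣ S ∣
  ... | yes large = large
  ... | no  ¬large = ⊥-elim (ℕ.<-irrefl refl (ℕ.≤-trans (ℕ.≤-trans (s≤s (s≤s z≤n)) 3≤n)
                                                       (ℕ.≤-trans (ℕ.≤-reflexive (≡.sym ∣S∣≡n)) small)))
    where
    small : ∣ S ∣ ℕ.≤ 1
    small = ℕ.≤-pred (ℕ.≰⇒> ¬large)

    ∣S∣≡n : ∣ S ∣ ≡ n G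
    ∣S∣≡n = begin
      ∣ S ∣                          ≡⟨ cong ∣_∣ (iterate-fixed (small-set-stuck small) (n G)) ⟨
      ∣ iterate G (n G) round S ∣    ≡⟨ cong ∣_∣ full ⟩
      ∣ Subset.⊤ {n G} ∣             ≡⟨ ∣⊤∣≡n (n G) ⟩
      n G                            ∎
      where open ≡.≡-Reasoning

corollary10 : (G : Graph) → TwoConnected G → Chordal G →
    (θ : Fin (n G) → ℤ) → (∀ v → θ v ≤ + 2) →
    MinSeedIs G θ 2 ⇔ (∀ v → θ v ≡ + 2)
corollary10 G tc chordal θ θ≤2 = mk⇔ only-if if
  where
  open GraphTheory G
  open Percolation G tc chordal θ θ≤2

  -- A vertex of threshold ≤ 1 would make a single neighbour a seed.
  only-if : MinSeedIs G θ 2 → ∀ v → θ v ≡ + 2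
  only-if (_ , minimal) v with θ v ℤ.≟ + 2 | has-neighbour tc v
  ... | yes θv≡2 | _       = θv≡2
  ... | no  θv≢2 | w , v~w =
    ⊥-elim (ℕ.<-irrefl refl (subst (2 ℕ.≤_) (∣⁅x⁆∣≡1 w) (minimal ⁅ w ⁆ (weak-vertex-seed θv≤1 v~w))))
    where
    θv≤1 : θ v ≤ + 1
    θv≤1 = ℤ.i<j⇒i≤pred[j] (ℤ.≤∧≢⇒< (θ≤2 v) θv≢2)

  if : (∀ v → θ v ≡ + 2) → MinSeedIs G θ 2
  if θ≡2 with has-neighbour tc (fromℕ< (ℕ.≤-trans (s≤s z≤n) (proj₁ tc)))
  ... | v , u~v =
    (⁅ _ ⁆ ∪ ⁅ v ⁆ , edge-seed u~v , ∣⁅x⁆∪⁅y⁆∣≡2 (~⇒≢ u~v)) ,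
    λ S full → ThresholdTwo.seeds-are-large G θ θ≡2 (proj₁ tc) full
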